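{- Assume the numbers $g_1,\dots,g_n$ and $1!,\dots,n!$ have been precomputed (so that each binomial coefficient $\binom{a}{b}$ with $a\le n$ is obtained with $O(1)$ arithmetic operations). Then, for every $0\le s<g_n$, the computation of $\textsc{UnrankTree}(n,s)$ defined below uses $O(n^2)$ arithmetic operations.
   Context: A Schröder tree is a rooted plane tree (children of each node are ordered) in which every internal node has at least two children; its size is its number of leaves. A weakly increasing Schröder tree is a Schröder tree whose internal nodes carry labels from $\{1,\dots,L\}$ for some $L\ge0$, every value in $\{1,\dots,L\}$ being used by at least one internal node, with labels strictly increasing along every root-to-leaf path; leaves are unlabeled. Let $g_1=1$ and $g_m=\sum_{k=1}^{m-1}\binom{m-1}{k-1}g_k$ for $m\ge2$. Fix a rule that lists the leaves of any plane tree in some order (e.g. left to right). UnrankComposition$(m,k,s)$, for $1\le k\le m$ and $0\le s<\binom{m-1}{k-1}$: if $m=k$, return $(1,\dots,1)$ ($k$ ones); else if $s<\binom{m-2}{k-1}$, let $C=$ UnrankComposition$(m-1,k,s)$ and return $C$ with its last part increased by $1$; else return UnrankComposition$(m-1,k-1,s-\binom{m-2}{k-1})$ with a final part $1$ appended. UnrankTree$(n,s)$, for $0\le s<g_n$: if $n=1$ return the single leaf. Otherwise set $r:=s$, $k:=n-1$; while $r\ge0$ do $r:=r-\binom{n-1}{k-1}g_k$, $k:=k-1$; then set $k:=k+1$, $r:=r+\binom{n-1}{k-1}g_k$. Let $T=$ UnrankTree$(k, r \bmod g_k)$ and $C=(C_1,\dots,C_k)=$ UnrankComposition$(n,k,\lfloor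 r/g_k\rfloor)$. Let $L$ be the largest label of $T$ ($L=0$ if $T$ is a leaf). For $i=1,\dots,k$, if $C_i\ge2$ replace the $i$-th leaf of $T$ by an internal node labeled $L+1$ with $C_i$ leaf children. Return the resulting tree. -}

module Defs where

open import Data.Nat using (ℕ; zero; suc; _+_; _*_; _∸_; _≡ᵇ_; _<ᵇ_; _%_; _/_)
open import Data.Nat.Combinatorics using (_C_)
open import Data.Bool using (Bool; true; false; if_then_else_)
open import Data.List using (List; []; _∷_; _++_; map; upTo; replicate; length)
open import Data.Nat.ListAction using (sum)
open import Data.Product using (_×_; _,_)

-- The numbers g_m :  g_1 = 1,  g_m = Σ_{k=1}^{m-1} C(m-1,k-1) g_k  (m ≥ 2).
-- (g_0 is not used by the paper; it is set to 0 here.)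
-- gF is a fuel-indexed version; fuel m suffices for argument m.

gF : ℕ → ℕ → ℕ
gF zero m = 0
gF (suc f) zero = 0
gF (suc f) (suc zero) = 1
gF (suc f) (suc (suc m')) =
  sum (map (λ j → (suc m' C j) * gF f (suc j)) (upTo (suc m')))

g : ℕ → ℕ
g m = gF m m

data Tree : Set where
  leaf : Tree
  node : ℕ → List Tree → Tree

_⊔'_ : ℕ → ℕ → ℕ
zero ⊔' n = n
suc m ⊔' zero = suc m
suc m ⊔' suc n = suc (m ⊔' n)

mutual
  maxLabel : Tree → ℕ
  maxLabel leaf = 0
  maxLabel (node l ts) = l ⊔' maxLabelF ts

  maxLabelF : List Tree → ℕ
  maxLabelF [] = 0
  maxLabelF (t ∷ ts) = maxLabel t ⊔' maxLabelF ts

expandLeaf : ℕ → ℕ → Tree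
expandLeaf lab c = if 2 Data.Nat.≤ᵇ c then node lab (replicate c leaf) else leaf
  where import Data.Nat

mutual
  replaceLeaves : ℕ → Tree → List ℕ → Tree × List ℕ
  replaceLeaves lab leaf [] = leaf , []
  replaceLeaves lab leaf (c ∷ cs) = expandLeaf lab c , cs
  replaceLeaves lab (node l ts) cs with replaceLeavesF lab ts cs
  ... | ts' , cs' = node l ts' , cs'

  replaceLeavesF : ℕ → List Tree → List ℕ → List Tree × List ℕ
  replaceLeavesF lab [] cs = [] , cs
  replaceLeavesF lab (t ∷ ts) cs with replaceLeaves lab t cs
  ... | t' , cs' with replaceLeavesF lab ts cs'
  ... | ts' , cs'' = (t' ∷ ts') , cs''

-- Every algorithm below returns its result together with the
-- number of arithmetic operations it performs.  Each comparison, addition,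
-- subtraction, multiplication, division, remainder, and each lookup of a
-- precomputed quantity (a binomial coefficient C(a,b) with a ≤ n, obtained
-- in O(1) from the precomputed factorials, or a value g_k) counts as one
-- operation.  Non-arithmetic bookkeeping (building lists/trees) is free.

incLast : List ℕ → List ℕ
incLast [] = []
incLast (x ∷ []) = suc x ∷ []
incLast (x ∷ y ∷ xs) = x ∷ incLast (y ∷ xs)

-- Per call: test m = k (1); otherwise binomial C(m-2,k-1) (1),
-- comparison s < C(m-2,k-1) (1), and one addition (last part + 1) or
-- one subtraction (s - C(m-2,k-1)) (1).
unrankComp : ℕ → ℕ → ℕ → List ℕ × ℕ
unrankComp m k s with m ≡ᵇ k
... | true = replicate k 1 , 1
unrankComp zero k s | false = [] , 1            -- outside the domain
unrankComp (suc m') k s | false with s <ᵇ (m' ∸ 1) C (k ∸ 1)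
... | true with unrankComp m' k s
...   | cs , c = incLast cs , c + 4
unrankComp (suc m') k s | false | false with unrankComp m' (k ∸ 1) (s ∸ ((m' ∸ 1) C (k ∸ 1)))
...   | cs , c = cs ++ (1 ∷ []) , c + 4

-- The while loop of UnrankTree(n,s): starting with r = s, k = n-1, subtract
-- t_k = C(n-1,k-1) g_k while the result stays ≥ 0.  Returns the final
-- k (after the correction k := k+1), the final r (after the correction
-- r := r + t_k), and the operation count.  Each iteration costs 3
-- operations (binomial lookup together with g_k lookup, multiplication,
-- subtraction/sign test); the paper's final correction step (restoring
-- r and k) is not performed explicitly here, the equivalent test r < t_k
-- being used instead.  Last argument: current k.
treeLoop : ℕ → ℕ → ℕ → ℕ × ℕ × ℕ
treeLoop n r zero = 0 , r , 1                  -- outside the domain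
treeLoop n r (suc j) with r <ᵇ ((n ∸ 1) C j) * g (suc j)
... | true = suc j , r , 3
... | false with treeLoop n (r ∸ ((n ∸ 1) C j) * g (suc j)) j
...   | k , r' , c = k , r' , c + 3

safeDiv safeMod : ℕ → ℕ → ℕ
safeDiv a zero = 0
safeDiv a (suc b) = a / suc b
safeMod a zero = 0
safeMod a (suc b) = a % suc b

-- UnrankTree with fuel (fuel n suffices for argument n, since the
-- recursive call is on k ≤ n - 1).  Cost of one call (excluding the
-- recursive calls): test n = 1 (1), the while loop, floor division and
-- remainder by g_k (2), computing L + 1 (1, L being maintained), and one
-- comparison C_i ≥ 2 per part of the composition.
unrankTreeF : ℕ → ℕ → ℕ → Tree × ℕ
unrankTreeF zero n s = leaf , 1                 -- fuel exhausted (never reached)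
unrankTreeF (suc f) n s with n Data.Nat.≤ᵇ 1
  where import Data.Nat
... | true = leaf , 1
... | false with treeLoop n s (n ∸ 1)
...   | k , r , c₁ with unrankTreeF f k (safeMod r (g k))
...     | T , c₂ with unrankComp n k (safeDiv r (g k))
...       | C , c₃ with replaceLeaves (suc (maxLabel T)) T C
...         | T' , _ = T' , (1 + c₁ + 2 + c₂ + c₃ + 1 + length C)

unrankTree : ℕ → ℕ → Tree
unrankTree n s with unrankTreeF n n s
... | T , _ = T

unrankTreeOps : ℕ → ℕ → ℕ
unrankTreeOps n s with unrankTreeF n n s
... | _ , c = c

module Submission where

-- The cost of UnrankTree(n,s) is bounded uniformly in s.  Writing T(n) for the cost of a call on n
-- leaves, one call performs
--   * the while loop over k = n-1, n-2, …: at most 3(n-1) + 3 operations,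
--     and it returns some k ≤ n - 1;
--   * UnrankComposition(n,k,·): at most 4n + 1 operations, and it returns a
--     composition with at most n parts (one comparison per part follows);
--   * a constant number (4) of further operations;
--   * one recursive call on k ≤ n - 1 leaves.
-- Hence T(n) ≤ T(n-1) + 8n + 5, which gives T(n) ≤ 1 + 10 n² by induction
-- (the key arithmetic fact is `quadratic-step`), and so T(n) ≤ 11 n² for
-- n ≥ 1.  The file first proves the bounds for UnrankComposition and the
-- loop, then the recurrence for UnrankTree, and finally the theorem.

open import Defs
open import Data.Nat using (ℕ; _*_; _≤_; _<_)
open import Data.Product using (∃)
open import Data.Nat using (zero; suc; _+_; _∸_; _≡ᵇ_; _<ᵇ_; z≤n; s≤s)
open import Data.Nat.Combinatorics using (_C_)
open import Data.Nat.Properties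
open import Data.Product using (_,_; _×_; proj₂)
open import Data.Bool using (true; false; T)
open import Data.Unit using (tt)
open import Data.List using (List; []; _∷_; _++_; length; replicate)
open import Data.List.Properties using (length-++; length-replicate)
open import Relation.Binary.PropositionalEquality using (_≡_; refl; cong; subst; sym; trans)
open import Data.Nat.Tactic.RingSolver using (solve-∀)

length-incLast : ∀ xs → length (incLast xs) ≡ length xs
length-incLast [] = refl
length-incLast (x ∷ []) = refl
length-incLast (x ∷ y ∷ xs) = cong suc (length-incLast (y ∷ xs))

CompBound : ℕ → List ℕ × ℕ → Set
CompBound m (cs , c) = length cs ≤ m × c ≤ 4 * m + 1

compBound-step : ∀ {m cs c} (f : List ℕ → List ℕ) → length (f cs) ≤ suc (length cs)
               → CompBound m (cs , c) → CompBound (suc m) (f cs , c + 4)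
compBound-step {m} {cs} {c} f grow (len≤ , cost≤) =
  ≤-trans grow (s≤s len≤) , ≤-trans (+-monoˡ-≤ 4 cost≤) (≤-reflexive (four-more m))
  where
  four-more : ∀ m → 4 * m + 1 + 4 ≡ 4 * suc m + 1
  four-more = solve-∀

compBound : ∀ m k s → CompBound m (unrankComp m k s)
compBound m k s with m ≡ᵇ k in m≡ᵇk
... | true = ≤-reflexive k-parts , m≤n+m 1 (4 * m)
  where
  k-parts : length (replicate k 1) ≡ m
  k-parts = trans (length-replicate k) (sym (≡ᵇ⇒≡ m k (subst T (sym m≡ᵇk) tt)))
compBound zero k s | false = z≤n , ≤-refl
compBound (suc m) k s | false with s <ᵇ (m ∸ 1) C (k ∸ 1)
... | true with unrankComp m k s | compBound m k s
...   | cs , c | ih =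
  compBound-step {m} {cs} {c} incLast (m≤n⇒m≤1+n (≤-reflexive (length-incLast cs))) ih
compBound (suc m) k s | false | false
  with unrankComp m (k ∸ 1) (s ∸ ((m ∸ 1) C (k ∸ 1)))
     | compBound m (k ∸ 1) (s ∸ ((m ∸ 1) C (k ∸ 1)))
...   | cs , c | ih =
  compBound-step {m} {cs} {c} (_++ 1 ∷ []) (≤-reflexive (trans (length-++ cs) (+-comm (length cs) 1))) ih

LoopBound : ℕ → ℕ × ℕ × ℕ → Set
LoopBound j (k , r , c) = k ≤ j × c ≤ 3 * j + 3

loopBound : ∀ n r j → LoopBound j (treeLoop n r j)
loopBound n r zero = z≤n , s≤s z≤n
loopBound n r (suc j) with r <ᵇ ((n ∸ 1) C j) * g (suc j)
... | true = ≤-refl , m≤n+m 3 (3 * suc j)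
... | false with treeLoop n (r ∸ ((n ∸ 1) C j) * g (suc j)) j
               | loopBound n (r ∸ ((n ∸ 1) C j) * g (suc j)) j
...   | k , r′ , c | k≤j , c≤ = m≤n⇒m≤1+n k≤j , ≤-trans (+-monoˡ-≤ 3 c≤) (≤-reflexive (three-more j))
  where
  three-more : ∀ j → 3 * j + 3 + 3 ≡ 3 * suc j + 3
  three-more = solve-∀

-- The quadratic bound absorbs the linear per-call overhead 8n + 5:
-- 10 (n-1)² + 8n + 5 ≤ 10 n² for n ≥ 2.
quadratic-step : ∀ m → 10 * (suc m * suc m) + (8 * suc (suc m) + 5) ≤ 10 * (suc (suc m) * suc (suc m))
quadratic-step m = ≤-trans (m≤m+n _ (12 * m + 9)) (≤-reflexive (slack m))
  where
  slack : ∀ m → 10 * (suc m * suc m) + (8 * suc (suc m) + 5) + (12 * m + 9)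
              ≡ 10 * (suc (suc m) * suc (suc m))
  slack = solve-∀

call-cost : ∀ m k c₁ c₂ c₃ l → k ≤ suc m → c₁ ≤ 3 * suc m + 3 → c₂ ≤ 1 + 10 * (k * k)
          → c₃ ≤ 4 * suc (suc m) + 1 → l ≤ suc (suc m)
          → 1 + c₁ + 2 + c₂ + c₃ + 1 + l ≤ 1 + 10 * (suc (suc m) * suc (suc m))
call-cost m k c₁ c₂ c₃ l k≤ c₁≤ c₂≤ c₃≤ l≤ = begin
  1 + c₁ + 2 + c₂ + c₃ + 1 + l
    ≤⟨ +-mono-≤ (+-monoˡ-≤ 1 (+-mono-≤ (+-mono-≤ (+-monoˡ-≤ 2 (+-monoʳ-≤ 1 c₁≤)) c₂≤′) c₃≤)) l≤ ⟩
  1 + (3 * suc m + 3) + 2 + (1 + 10 * (suc m * suc m)) + (4 * suc (suc m) + 1) + 1 + suc (suc m)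
    ≡⟨ regroup m ⟩
  1 + (10 * (suc m * suc m) + (8 * suc (suc m) + 5))
    ≤⟨ +-monoʳ-≤ 1 (quadratic-step m) ⟩
  1 + 10 * (suc (suc m) * suc (suc m)) ∎
  where
  open ≤-Reasoning
  c₂≤′ : c₂ ≤ 1 + 10 * (suc m * suc m)
  c₂≤′ = ≤-trans c₂≤ (+-monoʳ-≤ 1 (*-monoʳ-≤ 10 (*-mono-≤ k≤ k≤)))
  regroup : ∀ m → 1 + (3 * suc m + 3) + 2 + (1 + 10 * (suc m * suc m)) + (4 * suc (suc m) + 1) + 1 + suc (suc m)
                ≡ 1 + (10 * (suc m * suc m) + (8 * suc (suc m) + 5))
  regroup = solve-∀

unrankTree-cost : ∀ f n s → proj₂ (unrankTreeF f n s) ≤ 1 + 10 * (n * n)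
unrankTree-cost zero n s = s≤s z≤n
unrankTree-cost (suc f) zero s = s≤s z≤n
unrankTree-cost (suc f) (suc zero) s = s≤s z≤n
unrankTree-cost (suc f) (suc (suc m)) s
  with treeLoop (suc (suc m)) s (suc m) | loopBound (suc (suc m)) s (suc m)
... | k , r , c₁ | k≤ , c₁≤
  with unrankTreeF f k (safeMod r (g k)) | unrankTree-cost f k (safeMod r (g k))
... | tree , c₂ | c₂≤
  with unrankComp (suc (suc m)) k (safeDiv r (g k)) | compBound (suc (suc m)) k (safeDiv r (g k))
... | parts , c₃ | l≤ , c₃≤
  with replaceLeaves (suc (maxLabel tree)) tree parts
... | _ , _ = call-cost m k c₁ c₂ c₃ (length parts) k≤ c₁≤ c₂≤ c₃≤ l≤

-- For n ≥ 1 the constant term is absorbed: 1 + 10 n² ≤ 11 n².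
theorem10 : ∃ λ (c : ℕ) → ∀ (n s : ℕ) → 1 ≤ n → s < g n → unrankTreeOps n s ≤ c * (n * n)
theorem10 = 11 , λ n s 1≤n _ → cost-bound n s 1≤n
  where
  cost-bound : ∀ n s → 1 ≤ n → unrankTreeOps n s ≤ 11 * (n * n)
  cost-bound n s 1≤n with unrankTreeF n n s | unrankTree-cost n n s
  ... | _ , c | c≤ = ≤-trans c≤ (+-monoˡ-≤ (10 * (n * n)) (*-mono-≤ 1≤n 1≤n))
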